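{- For every $h\in\mathbb{N}$, the morphism $\varphi_h$ is overlap-free. Consequently $\varphi$ is an overlap-free morphism.
   Context: $\mathbb{N}=\{0,1,2,\ldots\}$ is an alphabet; $x\cdot y$ denotes concatenation. An overlap is a word $cxcxc$ with $c$ a letter and $x$ a possibly empty word; a word is overlap-free if it has no overlap as a factor; a morphism is overlap-free if it maps every overlap-free word (in its domain) to an overlap-free word. $S$ is the left cyclic shift $S(cx)=xc$ and $S^{ -1}$ its inverse, $S^{ -1}(xc)=cx$. For each $h\in\mathbb{N}$ the morphism $\varphi_h \colon \{0,\ldots,h\}^* \to \{0,\ldots,h+1\}^*$ is defined recursively by $\varphi_h(h') = \varphi_{h'}(h')$ for $h'<h$ and $\varphi_h(h) = \big(S^{ -1}(\varphi_{h-1}\circ\cdots\circ\varphi_0(00))\big)\cdot(h+1)$ (so $\varphi_0(0)=001$); $\varphi\colon\mathbb{N}^*\to\mathbb{N}^*$ is the common extension of all $\varphi_h$, i.e. $\varphi(h)=S^{ -1}(\varphi^h(00))\cdot(h+1)$. -}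

module Defs where

open import Data.Nat using (ℕ; zero; suc; _≤_; _≤ᵇ_)
open import Data.Bool using (if_then_else_)
open import Data.List using (List; []; _∷_; _++_; [_]; concatMap; reverse)
open import Data.Product using (∃-syntax; _×_)
open import Relation.Binary.PropositionalEquality using (_≡_)
open import Relation.Nullary using (¬_)

Word : Set
Word = List ℕ

overlapWord : ℕ → Word → Word
overlapWord c x = c ∷ x ++ c ∷ x ++ [ c ]

HasOverlap : Word → Set
HasOverlap w = ∃[ u ] ∃[ v ] ∃[ c ] ∃[ x ] (w ≡ u ++ overlapWord c x ++ v)

OverlapFree : Word → Set
OverlapFree w = ¬ HasOverlap w

ext : (ℕ → Word) → Word → Word
ext f w = concatMap f w

-- Inverse cyclic shift S⁻¹(x c) = c x  (S⁻¹ of the empty word is empty; never used).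
shiftR : Word → Word
shiftR w with reverse w
... | []    = []
... | c ∷ r = c ∷ reverse r

mutual
  -- phi h c = φ_h(c) for c ≤ h (values for c > h are irrelevant junk).
  -- φ_h(h') = φ_{h'}(h') for h' < h, and
  -- φ_h(h) = S⁻¹(φ_{h-1} ∘ ⋯ ∘ φ_0 (00)) · (h+1).
  phi : ℕ → ℕ → Word
  phi zero    c = shiftR (0 ∷ 0 ∷ []) ++ [ 1 ]
  phi (suc h) c = if c ≤ᵇ h then phi h c
                  else shiftR (ext (phi h) (comp h (0 ∷ 0 ∷ []))) ++ [ suc (suc h) ]

  comp : ℕ → Word → Word
  comp zero    w = w
  comp (suc k) w = ext (phi k) (comp k w)

φₕ : ℕ → Word → Word
φₕ h = ext (phi h)

φ : Word → Word
φ = ext (λ c → phi c c)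

-- Write φ(a) = T a · (a+1) with T a = a · Y a · a · Y a, where Y a uses only letters
-- below a and, for a ≥ 1, ends with 0; then P h = Y h · h = φʰ(0).  Let o be an overlap
-- in φ(w) with w overlap-free, and m its largest letter.  Letters above m cut φ(w) into
-- pieces, so o lies in φ(u) · T m for a factor u of w over letters below m, or inside
-- some Y a, a factor of φ(P (a - 1)), with a > m; there the argument restarts on the
-- smaller alphabet, P (a - 1) being overlap-free by induction on the alphabet.  In
-- φ(u) · T m the letter m occurs only as the last letter of a block φ(m - 1) or as one
-- of the two m's of T m.  Since Y m ends with 0 and no φ(b) does, the first m of o and
-- the m one period later both end blocks; as the blocks φ(b) have pairwise distinct
-- first letters and pairwise distinct last letters, the blocks around them
-- synchronise, and o lifts to an overlap in u.

module Submission where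

open import Defs
open import Data.Bool using (true; false)
open import Data.Empty using (⊥; ⊥-elim)
open import Data.List using (List; []; _∷_; _++_; [_]; _∷ʳ_; reverse; length; head; concatMap)
open import Data.List.Extrema.Nat using (max; ⊥≤max; xs≤max; argmax-sel)
open import Data.List.Membership.Propositional using (_∈_; _∉_)
open import Data.List.Membership.Propositional.Properties using (∈-++⁺ˡ; ∈-++⁺ʳ; ∈-++⁻; ∈-insert)
open import Data.List.Properties
  using (++-assoc; ++-identityʳ; ++-identityʳ-unique; ++-cancelˡ; ++-conicalʳ; ++-monoid;
         ∷-injective; ∷-injectiveˡ; ∷-injectiveʳ; ∷ʳ-injective; ∷ʳ-++;
         length-++; length-++-≤ˡ; length-++-≤ʳ; length-reverse;
         reverse-++; reverse-involutive; unfold-reverse; concatMap-++)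
open import Data.List.Relation.Unary.All using (All; []; _∷_; lookup; tabulate) renaming (map to All-map)
open import Data.List.Relation.Unary.All.Properties using (++⁺; ++⁻ˡ; ++⁻ʳ; concat⁺; map⁺)
open import Data.List.Relation.Unary.Any using (here; there)
open import Data.List.Reverse using (reverseView; []; _∶_∶ʳ_)
open import Data.Maybe using (just)
open import Data.Maybe.Properties using (just-injective)
open import Data.Nat using (ℕ; zero; suc; _≤_; _<_; _+_; _≤ᵇ_; _<ᵇ_; z≤n; s≤s; z<s)
open import Data.Nat.Induction using (<-rec)
open import Data.Nat.Properties
open import Data.Product using (_×_; ∃-syntax; _,_; proj₁; proj₂)
open import Data.Sum using (_⊎_; inj₁; inj₂; [_,_]′)
open import Data.Unit using (tt)
open import Function using (_∘_; id)
open import Function.Definitions using (Injective)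
open import Relation.Binary.Definitions using (DecidableEquality)
open import Relation.Binary.PropositionalEquality hiding ([_])
open import Relation.Nullary using (¬_; yes; no)
open import Tactic.MonoidSolver using (solve)

module _ {A : Set} where

  ++-equidivisible : ∀ (P R S Q : List A) → P ++ R ≡ S ++ Q →
    (∃[ S₁ ] S ≡ P ++ S₁ × R ≡ S₁ ++ Q) ⊎ (∃[ P₁ ] P ≡ S ++ P₁ × Q ≡ P₁ ++ R)
  ++-equidivisible []      R S       Q eq = inj₁ (S , refl , eq)
  ++-equidivisible (p ∷ P) R []      Q eq = inj₂ (p ∷ P , refl , sym eq)
  ++-equidivisible (p ∷ P) R (s ∷ S) Q eq with ∷-injective eq
  ... | refl , eq′ with ++-equidivisible P R S Q eq′
  ...   | inj₁ (S₁ , e₁ , e₂) = inj₁ (S₁ , cong (p ∷_) e₁ , e₂)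
  ...   | inj₂ (P₁ , e₁ , e₂) = inj₂ (P₁ , cong (p ∷_) e₁ , e₂)

  split-at-unique : ∀ {d} (Y R X Z : List A) → d ∉ Y → d ∉ R →
                    Y ++ d ∷ R ≡ X ++ d ∷ Z → X ≡ Y × Z ≡ R
  split-at-unique Y R X Z d∉Y d∉R eq with ++-equidivisible Y (_ ∷ R) X (_ ∷ Z) eq
  ... | inj₁ ([] , e₁ , e₂)     = trans e₁ (++-identityʳ Y) , sym (∷-injectiveʳ e₂)
  ... | inj₁ (s ∷ S₁ , _ , e₂) with ∷-injective e₂
  ...   | refl , e₃ = ⊥-elim (d∉R (subst (_ ∈_) (sym e₃) (∈-insert S₁)))
  split-at-unique Y R X Z d∉Y d∉R eq | inj₂ ([] , e₁ , e₂) =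
    sym (trans e₁ (++-identityʳ X)) , ∷-injectiveʳ e₂
  split-at-unique Y R X Z d∉Y d∉R eq | inj₂ (p ∷ P₁ , e₁ , e₂) with ∷-injective e₂
  ... | refl , _ = ⊥-elim (d∉Y (subst (_ ∈_) (sym e₁) (∈-insert X)))

  split-at-last : ∀ {d e} (U X Z : List A) → d ∉ U → U ∷ʳ e ≡ X ++ d ∷ Z →
                  X ≡ U × e ≡ d × Z ≡ []
  split-at-last U X Z d∉U eq with ++-equidivisible U [ _ ] X (_ ∷ Z) eq
  ... | inj₁ ([] , e₁ , e₂) with ∷-injective e₂
  ...   | refl , e₃ = trans e₁ (++-identityʳ U) , refl , sym e₃
  split-at-last U X Z d∉U eq | inj₁ (s ∷ S₁ , _ , e₂) with ++-conicalʳ S₁ (_ ∷ Z) (sym (∷-injectiveʳ e₂))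
  ... | ()
  split-at-last U X Z d∉U eq | inj₂ ([] , e₁ , e₂) with ∷-injective e₂
  ... | refl , e₃ = sym (trans e₁ (++-identityʳ X)) , refl , e₃
  split-at-last U X Z d∉U eq | inj₂ (p ∷ P₁ , e₁ , e₂) with ∷-injective e₂
  ... | refl , _ = ⊥-elim (d∉U (subst (_ ∈_) (sym e₁) (∈-insert X)))

  split-at-first : DecidableEquality A → ∀ {d} xs → d ∈ xs →
                   ∃[ s₁ ] ∃[ s₂ ] xs ≡ s₁ ++ d ∷ s₂ × d ∉ s₁
  split-at-first _≟_ {d} (y ∷ xs) d∈ with d ≟ y | d∈
  ... | yes refl | _        = [] , xs , refl , λ ()
  ... | no d≢y   | here d≡y = ⊥-elim (d≢y d≡y)
  ... | no d≢y   | there d∈xs with split-at-first _≟_ xs d∈xs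
  ...   | s₁ , s₂ , eq , d∉s₁ =
    y ∷ s₁ , s₂ , cong (y ∷_) eq , λ { (here d≡y) → d≢y d≡y ; (there d∈s₁) → d∉s₁ d∈s₁ }

  head-of-∷ʳ : ∀ {c d : A} {x} s₁ s₂ → c ∷ x ≡ s₁ ++ d ∷ s₂ → ∃[ r ] s₁ ∷ʳ d ≡ c ∷ r
  head-of-∷ʳ []      s₂ eq = [] , cong [_] (sym (∷-injectiveˡ eq))
  head-of-∷ʳ (s ∷ s₁) s₂ eq = s₁ ∷ʳ _ , cong (_∷ (s₁ ∷ʳ _)) (sym (∷-injectiveˡ eq))

  EndsWith : A → List A → Set
  EndsWith d w = ∃[ R ] w ≡ R ∷ʳ d

  EndsWith-++⁺ʳ : ∀ {d} X {E} → EndsWith d E → EndsWith d (X ++ E)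
  EndsWith-++⁺ʳ X (R , refl) = X ++ R , sym (++-assoc X R [ _ ])

  EndsWith-++⁻ʳ : ∀ {d} X E → EndsWith d (X ++ E) → E ≡ [] ⊎ EndsWith d E
  EndsWith-++⁻ʳ []           E       ends      = inj₂ ends
  EndsWith-++⁻ʳ (x ∷ X)      []      _         = inj₁ refl
  EndsWith-++⁻ʳ (x ∷ [])     (e ∷ E) ([] , ())
  EndsWith-++⁻ʳ (x ∷ x′ ∷ X) (e ∷ E) ([] , ())
  EndsWith-++⁻ʳ (x ∷ X)      (e ∷ E) (r ∷ R , eq) = EndsWith-++⁻ʳ X (e ∷ E) (R , ∷-injectiveʳ eq)

  Factor : List A → List A → Set
  Factor o w = ∃[ L ] ∃[ R ] w ≡ L ++ o ++ R

  Factor-++⁺ˡ : ∀ {o X} Y → Factor o X → Factor o (X ++ Y)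
  Factor-++⁺ˡ {o} Y (L , R , refl) = L , R ++ Y , solve (++-monoid A)

  Factor-prefix : ∀ X Y → Factor X (X ++ Y)
  Factor-prefix X Y = [] , Y , refl

  Factor-suffix : ∀ X Y → Factor Y (X ++ Y)
  Factor-suffix X Y = X , [] , cong (X ++_) (sym (++-identityʳ Y))

  Factor-trans : ∀ {o v w} → Factor o v → Factor v w → Factor o w
  Factor-trans {o} (L , R , refl) (L′ , R′ , refl) = L′ ++ L , R ++ R′ , solve (++-monoid A)

  Factor-avoiding : ∀ {o d} X Z → d ∉ o → Factor o (X ++ d ∷ Z) → Factor o X ⊎ Factor o Z
  Factor-avoiding {o} X Z d∉o (L , R , eq) with ++-equidivisible X (_ ∷ Z) L (o ++ R) eq
  ... | inj₁ (s ∷ S₁ , _ , e₂) = inj₂ (S₁ , R , ∷-injectiveʳ e₂)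
  ... | inj₁ ([] , _ , e₂) with o | e₂
  ...   | []     | refl = inj₂ ([] , Z , refl)
  ...   | _ ∷ _  | refl = ⊥-elim (d∉o (here refl))
  Factor-avoiding {o} X Z d∉o (L , R , eq) | inj₂ (P₁ , e₁ , e₂)
    with ++-equidivisible o R P₁ (_ ∷ Z) e₂
  ... | inj₁ (S₂ , f₁ , _) = inj₁ (L , S₂ , trans e₁ (cong (L ++_) f₁))
  ... | inj₂ ([] , f₁ , _) =
    inj₁ (L , [] , trans e₁ (cong (L ++_) (sym (trans (++-identityʳ o) (trans f₁ (++-identityʳ P₁))))))
  ... | inj₂ (p ∷ P₂ , f₁ , f₂) with ∷-injective f₂
  ...   | refl , _ = ⊥-elim (d∉o (subst (_ ∈_) (sym f₁) (∈-insert P₁)))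

OverlapFree-Factor : ∀ {v w} → Factor v w → OverlapFree w → OverlapFree v
OverlapFree-Factor v⊑w ovf (L , R , c , x , eq) with Factor-trans (L , R , eq) v⊑w
... | L′ , R′ , eq′ = ovf (L′ , R′ , c , x , eq′)

overlap-length : ∀ {w} → HasOverlap w → 3 ≤ length w
overlap-length (L , R , c , x , refl) = begin
  3                                   ≤⟨ s≤s (s≤s (length-++-≤ʳ [ c ] {x})) ⟩
  suc (length (c ∷ x ++ [ c ]))       ≤⟨ s≤s (length-++-≤ʳ (c ∷ x ++ [ c ]) {x}) ⟩
  length (overlapWord c x)            ≤⟨ length-++-≤ˡ (overlapWord c x) ⟩
  length (overlapWord c x ++ R)       ≤⟨ length-++-≤ʳ (overlapWord c x ++ R) {L} ⟩
  length (L ++ overlapWord c x ++ R)  ∎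
  where open ≤-Reasoning

bordered-overlap : ∀ (γ₁ γ₂ v v′ v″ : Word) → v ≡ v′ ++ γ₁ → v ≡ γ₂ ++ v″ →
                   (∀ P → v ≢ γ₂ ++ P ++ γ₁) → HasOverlap (γ₁ ++ v ++ γ₂)
bordered-overlap γ₁ γ₂ v v′ v″ e₁ e₂ apart
  with ++-equidivisible v′ γ₁ γ₂ v″ (trans (sym e₁) e₂)
... | inj₁ ([] , f₁ , _) =
  ⊥-elim (apart [] (trans e₁ (cong (_++ γ₁) (trans (sym (++-identityʳ v′)) (sym f₁)))))
... | inj₂ (P₁ , f₁ , _) = ⊥-elim (apart P₁ (trans e₁ (trans (cong (_++ γ₁) f₁) (++-assoc γ₂ P₁ γ₁))))
... | inj₁ (c ∷ S₁ , refl , refl) rewrite e₁ =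
  [] , S₁ , c , S₁ ++ v″ ++ v′ , rearrange [ c ] S₁
  where
  rearrange : ∀ C S → (C ++ S ++ v″) ++ (v′ ++ C ++ S ++ v″) ++ (v′ ++ C ++ S)
                    ≡ [] ++ (C ++ (S ++ v″ ++ v′) ++ C ++ (S ++ v″ ++ v′) ++ C) ++ S
  rearrange C S = solve (++-monoid ℕ)

module _ {A B : Set} where

  length-concatMap-++ : ∀ (g : A → List B) xs ys →
                  length (concatMap g (xs ++ ys)) ≡ length (concatMap g xs) + length (concatMap g ys)
  length-concatMap-++ g xs ys = trans (cong length (concatMap-++ g xs ys)) (length-++ (concatMap g xs))

  separated-by-weight : ∀ (g : A → List B) v γ₁ γ₂ →
    length (concatMap g v) < length (concatMap g γ₁) + length (concatMap g γ₂) → ∀ P → v ≢ γ₂ ++ P ++ γ₁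
  separated-by-weight g v γ₁ γ₂ lt P refl = <⇒≱ lt (begin
    length (concatMap g γ₁) + length (concatMap g γ₂)
      ≤⟨ +-monoʳ-≤ (length (concatMap g γ₁)) (m≤m+n (length (concatMap g γ₂)) (length (concatMap g P))) ⟩
    length (concatMap g γ₁) + (length (concatMap g γ₂) + length (concatMap g P))
      ≡⟨ +-comm (length (concatMap g γ₁)) _ ⟩
    length (concatMap g γ₂) + length (concatMap g P) + length (concatMap g γ₁)
      ≡⟨ cong (_+ length (concatMap g γ₁)) (sym (length-concatMap-++ g γ₂ P)) ⟩
    length (concatMap g (γ₂ ++ P)) + length (concatMap g γ₁)
      ≡⟨ sym (length-concatMap-++ g (γ₂ ++ P) γ₁) ⟩
    length (concatMap g ((γ₂ ++ P) ++ γ₁))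
      ≡⟨ cong (length ∘ concatMap g) (++-assoc γ₂ P γ₁) ⟩
    length (concatMap g (γ₂ ++ P ++ γ₁)) ∎)
    where open ≤-Reasoning

  concatMap-cong-All : ∀ {f g : A → List B} {w} → All (λ a → f a ≡ g a) w → concatMap f w ≡ concatMap g w
  concatMap-cong-All []         = refl
  concatMap-cong-All (eq ∷ eqs) = cong₂ _++_ eq (concatMap-cong-All eqs)

  All-concatMap : ∀ {P : B → Set} (g : A → List B) {w} → All (All P ∘ g) w → All P (concatMap g w)
  All-concatMap g ps = concat⁺ (map⁺ ps)

  reverse-concatMap : ∀ (g : A → List B) w → reverse (concatMap g w) ≡ concatMap (reverse ∘ g) (reverse w)
  reverse-concatMap g []      = refl
  reverse-concatMap g (a ∷ w) = begin
    reverse (g a ++ concatMap g w)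
      ≡⟨ reverse-++ (g a) (concatMap g w) ⟩
    reverse (concatMap g w) ++ reverse (g a)
      ≡⟨ cong (_++ reverse (g a)) (reverse-concatMap g w) ⟩
    concatMap (reverse ∘ g) (reverse w) ++ reverse (g a)
      ≡⟨ cong (concatMap (reverse ∘ g) (reverse w) ++_) (sym (++-identityʳ _)) ⟩
    concatMap (reverse ∘ g) (reverse w) ++ concatMap (reverse ∘ g) [ a ]
      ≡⟨ sym (concatMap-++ (reverse ∘ g) (reverse w) [ a ]) ⟩
    concatMap (reverse ∘ g) (reverse w ∷ʳ a)
      ≡⟨ cong (concatMap (reverse ∘ g)) (sym (unfold-reverse a w)) ⟩
    concatMap (reverse ∘ g) (reverse (a ∷ w)) ∎
    where open ≡-Reasoning

module Synchronisation {A B : Set} (g : A → List B) (hd : A → B)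
  (g-head : ∀ a → ∃[ r ] g a ≡ hd a ∷ r) (hd-injective : Injective _≡_ _≡_ hd) where

  head-of-image : ∀ a w {s S} → g a ++ w ≡ s ∷ S → hd a ≡ s
  head-of-image a w eq with g-head a
  ... | r , ea = proj₁ (∷-injective (trans (cong (_++ w) (sym ea)) eq))

  -- Tl is whatever follows g α; the guard forbids it to start like a block of β.
  prefix-sync : ∀ α β Tl S X X′ → All (λ b → head Tl ≢ just (hd b)) β →
    concatMap g α ++ Tl ≡ S ++ X → concatMap g β ≡ S ++ X′ →
    ∃[ γ ] ∃[ α′ ] ∃[ β′ ] α ≡ γ ++ α′ × β ≡ γ ++ β′ × length S ≤ length (concatMap g γ)
  prefix-sync α β Tl [] X X′ _ _ _ = [] , α , β , refl , refl , z≤n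
  prefix-sync α [] Tl (s ∷ S) X X′ _ _ ()
  prefix-sync [] (b ∷ β) Tl (s ∷ S) X X′ (b∤Tl ∷ _) eα eβ =
    ⊥-elim (b∤Tl (trans (cong head eα) (cong just (sym (head-of-image b (concatMap g β) eβ)))))
  prefix-sync (a ∷ α) (b ∷ β) Tl (s ∷ S) X X′ (_ ∷ guard) eα eβ
    with hd-injective (trans (head-of-image a (concatMap g α ++ Tl) eα′)
                             (sym (head-of-image b (concatMap g β) eβ)))
    where eα′ = trans (sym (++-assoc (g a) (concatMap g α) Tl)) eα
  ... | refl with ++-equidivisible (g a) (concatMap g β) (s ∷ S) X′ eβ
  ...   | inj₂ (P₁ , e , _) = [ a ] , α , β , refl , refl ,
    subst (λ z → length (s ∷ S) ≤ length z) (sym (trans (++-identityʳ (g a)) e)) (length-++-≤ˡ (s ∷ S))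
  ...   | inj₁ (S₁ , e₁ , e₂) with prefix-sync α β Tl S₁ X X′ guard tail-eq e₂
    where
    tail-eq : concatMap g α ++ Tl ≡ S₁ ++ X
    tail-eq = ++-cancelˡ (g a) _ _ (trans (sym (++-assoc (g a) (concatMap g α) Tl))
                (trans eα (trans (cong (_++ X) e₁) (++-assoc (g a) S₁ X))))
  ...     | γ , α′ , β′ , eα″ , eβ″ , le = a ∷ γ , α′ , β′ , cong (a ∷_) eα″ , cong (a ∷_) eβ″ , (begin
    length (s ∷ S)                   ≡⟨ cong length e₁ ⟩
    length (g a ++ S₁)               ≡⟨ length-++ (g a) ⟩
    length (g a) + length S₁         ≤⟨ +-monoʳ-≤ (length (g a)) le ⟩
    length (g a) + length (concatMap g γ)  ≡⟨ sym (length-++ (g a)) ⟩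
    length (concatMap g (a ∷ γ))           ∎)
    where open ≤-Reasoning

suffix-sync : ∀ {A B : Set} (g : A → List B) (tl : A → B) →
  (∀ a → ∃[ r ] g a ≡ r ∷ʳ tl a) → Injective _≡_ _≡_ tl →
  ∀ α β X X′ S → concatMap g α ≡ X ++ S → concatMap g β ≡ X′ ++ S →
  ∃[ γ ] ∃[ α′ ] ∃[ β′ ] α ≡ α′ ++ γ × β ≡ β′ ++ γ × length S ≤ length (concatMap g γ)
suffix-sync g tl g-last tl-injective α β X X′ S eα eβ
  with prefix-sync (reverse α) (reverse β) [] (reverse S) (reverse X) (reverse X′)
         (tabulate (λ _ ())) (reversed α X eα) (trans (sym (++-identityʳ _)) (reversed β X′ eβ))
  where
  reverse-head : ∀ a → ∃[ r ] reverse (g a) ≡ tl a ∷ r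
  reverse-head a with g-last a
  ... | r , ea = reverse r , trans (cong reverse ea) (reverse-++ r [ tl a ])
  open Synchronisation (reverse ∘ g) tl reverse-head tl-injective
  reversed : ∀ w Z → concatMap g w ≡ Z ++ S →
             concatMap (reverse ∘ g) (reverse w) ++ [] ≡ reverse S ++ reverse Z
  reversed w Z e = trans (++-identityʳ _)
    (trans (sym (reverse-concatMap g w)) (trans (cong reverse e) (reverse-++ Z S)))
... | γ , α′ , β′ , eα′ , eβ′ , le =
  reverse γ , reverse α′ , reverse β′ , unreverse α eα′ , unreverse β eβ′ ,
  subst₂ _≤_ (length-reverse S) weight le
  where
  unreverse : ∀ w {w′} → reverse w ≡ γ ++ w′ → w ≡ reverse w′ ++ reverse γ
  unreverse w e = trans (sym (reverse-involutive w)) (trans (cong reverse e) (reverse-++ γ _))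
  weight : length (concatMap (reverse ∘ g) γ) ≡ length (concatMap g (reverse γ))
  weight = begin
    length (concatMap (reverse ∘ g) γ)
      ≡⟨ cong (length ∘ concatMap (reverse ∘ g)) (sym (reverse-involutive γ)) ⟩
    length (concatMap (reverse ∘ g) (reverse (reverse γ)))
      ≡⟨ cong length (sym (reverse-concatMap g (reverse γ))) ⟩
    length (reverse (concatMap g (reverse γ)))
      ≡⟨ length-reverse (concatMap g (reverse γ)) ⟩
    length (concatMap g (reverse γ)) ∎
    where open ≡-Reasoning

φ₁ : ℕ → Word
φ₁ c = phi c c

phi-step : ∀ {h c} → c ≤ h → phi (suc h) c ≡ phi h c
phi-step {h} {c} c≤h with c ≤ᵇ h | ≤⇒≤ᵇ c≤h
... | true | _ = refl

phi-stable : ∀ {h c} → c ≤ h → phi h c ≡ φ₁ c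
phi-stable {zero} z≤n = refl
phi-stable {suc h} {c} c≤1+h with c ≤? h
... | yes c≤h = trans (phi-step c≤h) (phi-stable c≤h)
... | no  c≰h with refl ← ≤-antisym c≤1+h (≰⇒> c≰h) = refl

φₕ-φ : ∀ h w → All (_≤ h) w → φₕ h w ≡ φ w
φₕ-φ h w w≤h = concatMap-cong-All (All-map phi-stable w≤h)

φ₁-suc : ∀ h → φ₁ (suc h) ≡ shiftR (comp (suc h) (0 ∷ 0 ∷ [])) ++ [ suc (suc h) ]
φ₁-suc h with h <ᵇ h | <ᵇ⇒< h h
... | false | _   = refl
... | true  | h<h = ⊥-elim (n≮n h (h<h tt))

-- T a = S⁻¹(φᵃ(00)) is the shifted word in the definition of φ(a).
Y : ℕ → Word
Y zero    = []
Y (suc h) = φ (Y h) ++ h ∷ Y h ++ h ∷ Y h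

T : ℕ → Word
T a = a ∷ Y a ++ a ∷ Y a

P : ℕ → Word
P h = Y h ∷ʳ h

Shape : ℕ → Set
Shape a = φ₁ a ≡ T a ∷ʳ suc a × All (_< a) (Y a)

φ-P : ∀ h → φ₁ h ≡ T h ∷ʳ suc h → φ (P h) ≡ P (suc h)
φ-P h φ₁h = begin
  φ (Y h ++ [ h ])              ≡⟨ concatMap-++ φ₁ (Y h) [ h ] ⟩
  φ (Y h) ++ (φ₁ h ++ [])       ≡⟨ cong (φ (Y h) ++_) (trans (++-identityʳ (φ₁ h)) φ₁h) ⟩
  φ (Y h) ++ (T h ∷ʳ suc h)     ≡⟨ sym (++-assoc (φ (Y h)) (T h) [ suc h ]) ⟩
  P (suc h)                     ∎
  where open ≡-Reasoning

P-bounded : ∀ {h} → All (_< h) (Y h) → All (_≤ h) (P h)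
P-bounded Y<h = ++⁺ (All-map <⇒≤ Y<h) (≤-refl ∷ [])

comp-00 : ∀ h → (∀ b → b < h → Shape b) → comp h (0 ∷ 0 ∷ []) ≡ P h ++ P h
comp-00 zero    _     = refl
comp-00 (suc k) below = begin
  φₕ k (comp k (0 ∷ 0 ∷ []))   ≡⟨ cong (φₕ k) (comp-00 k (λ b b<k → below b (m<n⇒m<1+n b<k))) ⟩
  φₕ k (P k ++ P k)            ≡⟨ φₕ-φ k (P k ++ P k) (++⁺ Pk≤k Pk≤k) ⟩
  φ (P k ++ P k)               ≡⟨ concatMap-++ φ₁ (P k) (P k) ⟩
  φ (P k) ++ φ (P k)           ≡⟨ cong₂ _++_ φPk φPk ⟩
  P (suc k) ++ P (suc k)       ∎
  where
  open ≡-Reasoning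
  Pk≤k = P-bounded (proj₂ (below k ≤-refl))
  φPk  = φ-P k (proj₁ (below k ≤-refl))

shiftR-∷ʳ : ∀ xs c → shiftR (xs ∷ʳ c) ≡ c ∷ xs
shiftR-∷ʳ xs c with reverse (xs ∷ʳ c) | reverse-++ xs [ c ]
... | _ | refl = cong (c ∷_) (reverse-involutive xs)

shiftR-square : ∀ y a → shiftR ((y ∷ʳ a) ++ (y ∷ʳ a)) ≡ a ∷ y ++ a ∷ y
shiftR-square y a = begin
  shiftR ((y ∷ʳ a) ++ (y ∷ʳ a))  ≡⟨ cong shiftR (sym (++-assoc (y ∷ʳ a) y [ a ])) ⟩
  shiftR (((y ∷ʳ a) ++ y) ∷ʳ a)  ≡⟨ shiftR-∷ʳ ((y ∷ʳ a) ++ y) a ⟩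
  a ∷ (y ∷ʳ a) ++ y              ≡⟨ cong (a ∷_) (++-assoc y [ a ] y) ⟩
  a ∷ y ++ a ∷ y                 ∎
  where open ≡-Reasoning

φ₁-bounded : ∀ {a} → Shape a → All (_≤ suc a) (φ₁ a)
φ₁-bounded {a} (φ₁a , Y<a) = subst (All (_≤ suc a)) (sym φ₁a)
  (++⁺ (n≤1+n a ∷ ++⁺ Y≤1+a (n≤1+n a ∷ Y≤1+a)) (≤-refl ∷ []))
  where Y≤1+a = All-map (λ b<a → ≤-trans (<⇒≤ b<a) (n≤1+n a)) Y<a

shape-suc : ∀ h → (∀ b → b ≤ h → Shape b) → Shape (suc h)
shape-suc h below = φ₁-form , ++⁺ φY<1+h (n<1+n h ∷ ++⁺ Y<1+h (n<1+n h ∷ Y<1+h))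
  where
  Y<h = proj₂ (below h ≤-refl)
  Y<1+h = All-map m<n⇒m<1+n Y<h
  φY<1+h : All (_< suc h) (φ (Y h))
  φY<1+h = All-concatMap φ₁ (All-map (λ {b} b<h → All-map (λ c≤1+b → s≤s (≤-trans c≤1+b b<h))
                                                        (φ₁-bounded {b} (below b (<⇒≤ b<h)))) Y<h)
  φ₁-form : φ₁ (suc h) ≡ T (suc h) ∷ʳ suc (suc h)
  φ₁-form = begin
    φ₁ (suc h)
      ≡⟨ φ₁-suc h ⟩
    shiftR (comp (suc h) (0 ∷ 0 ∷ [])) ++ [ suc (suc h) ]
      ≡⟨ cong (λ z → shiftR z ++ [ suc (suc h) ]) (comp-00 (suc h) (λ b → below b ∘ ≤-pred)) ⟩
    shiftR (P (suc h) ++ P (suc h)) ++ [ suc (suc h) ]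
      ≡⟨ cong (_++ [ suc (suc h) ]) (shiftR-square (Y (suc h)) (suc h)) ⟩
    T (suc h) ∷ʳ suc (suc h) ∎
    where open ≡-Reasoning

shape : ∀ a → Shape a
shape = <-rec Shape step
  where
  step : ∀ a → (∀ {b} → b < a → Shape b) → Shape a
  step zero    _     = refl , []
  step (suc h) below = shape-suc h (λ b b≤h → below (s≤s b≤h))

φ₁-shape : ∀ a → φ₁ a ≡ T a ∷ʳ suc a
φ₁-shape a = proj₁ (shape a)

Y-bounded : ∀ a → All (_< a) (Y a)
Y-bounded a = proj₂ (shape a)

T-bounded : ∀ a → All (_≤ a) (T a)
T-bounded a = ≤-refl ∷ ++⁺ Y≤a (≤-refl ∷ Y≤a)
  where Y≤a = All-map <⇒≤ (Y-bounded a)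

∉-above : ∀ {m d o} → All (_≤ m) o → m < d → d ∉ o
∉-above o≤m m<d d∈o = <⇒≱ m<d (lookup o≤m d∈o)

∉-Y : ∀ m → m ∉ Y m
∉-Y m m∈Y = n≮n m (lookup (Y-bounded m) m∈Y)

mutual
  Y-ends-with-0 : ∀ k → EndsWith 0 (Y (suc k))
  Y-ends-with-0 k = EndsWith-++⁺ʳ (φ (Y k)) (T-ends-with-0 k)

  T-ends-with-0 : ∀ a → EndsWith 0 (T a)
  T-ends-with-0 zero    = [ 0 ] , refl
  T-ends-with-0 (suc k) = EndsWith-++⁺ʳ (suc k ∷ Y (suc k)) (EndsWith-++⁺ʳ [ suc k ] (Y-ends-with-0 k))

φ-∷ʳ : ∀ u a → φ (u ∷ʳ a) ≡ (φ u ++ T a) ∷ʳ suc a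
φ-∷ʳ u a = begin
  φ (u ++ [ a ])              ≡⟨ concatMap-++ φ₁ u [ a ] ⟩
  φ u ++ (φ₁ a ++ [])         ≡⟨ cong (φ u ++_) (trans (++-identityʳ (φ₁ a)) (φ₁-shape a)) ⟩
  φ u ++ (T a ∷ʳ suc a)       ≡⟨ sym (++-assoc (φ u) (T a) [ suc a ]) ⟩
  (φ u ++ T a) ∷ʳ suc a       ∎
  where open ≡-Reasoning

φ-last : ∀ u {R d} → φ u ≡ R ∷ʳ d → ∃[ a ] d ≡ suc a × EndsWith 0 R
φ-last u {R} {d} eq with reverseView u
... | [] with () ← ++-conicalʳ R [ d ] (sym eq)
... | u′ ∶ _ ∶ʳ a with ∷ʳ-injective (φ u′ ++ T a) R (trans (sym (φ-∷ʳ u′ a)) eq)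
...   | refl , refl = a , refl , EndsWith-++⁺ʳ (φ u′) (T-ends-with-0 a)

φ-not-ends-with-0 : ∀ u → ¬ EndsWith 0 (φ u)
φ-not-ends-with-0 u (R , eq) with φ-last u eq
... | _ , () , _

data Occurrence (m : ℕ) (u X Z : Word) : Set where
  in-image    : ∀ u₁ u₂ → u ≡ u₁ ++ u₂ → φ u₁ ≡ X ∷ʳ m → Z ≡ φ u₂ ++ T m → Occurrence m u X Z
  first-of-T  : X ≡ φ u → Z ≡ Y m ++ m ∷ Y m → Occurrence m u X Z
  second-of-T : X ≡ φ u ++ m ∷ Y m → Z ≡ Y m → Occurrence m u X Z

Occurrence-∷ : ∀ {m a u X S Z} → X ≡ φ₁ a ++ S → Occurrence m u S Z → Occurrence m (a ∷ u) X Z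
Occurrence-∷ {m} {a} {u} {X} {S} refl (in-image u₁ u₂ eu ef ez) =
  in-image (a ∷ u₁) u₂ (cong (a ∷_) eu) (trans (cong (φ₁ a ++_) ef) (sym (++-assoc (φ₁ a) S [ m ]))) ez
Occurrence-∷ refl (first-of-T refl ez) = first-of-T refl ez
Occurrence-∷ {m} {a} {u} refl (second-of-T refl ez) =
  second-of-T (sym (++-assoc (φ₁ a) (φ u) (m ∷ Y m))) ez

occurrence : ∀ {m} u → All (_< m) u → ∀ X Z → φ u ++ T m ≡ X ++ m ∷ Z → Occurrence m u X Z
occurrence []      _           []      Z eq = first-of-T refl (sym (∷-injectiveʳ eq))
occurrence {m} []  _           (x ∷ X) Z eq with ∷-injective eq
... | refl , eq′ with split-at-unique (Y m) (Y m) X Z (∉-Y m) (∉-Y m) eq′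
...   | refl , refl = second-of-T refl refl
occurrence {m} (a ∷ u) (a<m ∷ u<m) X Z eq
  with ++-equidivisible (φ₁ a) (φ u ++ T m) X (m ∷ Z) (trans (sym (++-assoc (φ₁ a) (φ u) (T m))) eq)
... | inj₁ (S₁ , e₁ , e₂) = Occurrence-∷ e₁ (occurrence u u<m S₁ Z e₂)
... | inj₂ ([] , e₁ , e₂) =
  Occurrence-∷ (sym (trans (++-identityʳ (φ₁ a)) (trans e₁ (++-identityʳ X)))) (occurrence u u<m [] Z (sym e₂))
... | inj₂ (p ∷ P₁ , e₁ , e₂) with ∷-injective e₂
...   | refl , e₃ with split-at-last (T a) X P₁ (∉-above (T-bounded a) a<m) (trans (sym (φ₁-shape a)) e₁)
...     | refl , refl , refl = in-image [ a ] u refl (trans (++-identityʳ (φ₁ a)) (φ₁-shape a)) e₃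

φ₁-head : ∀ a → ∃[ r ] φ₁ a ≡ a ∷ r
φ₁-head a = _ , φ₁-shape a

φ₁-last : ∀ a → ∃[ r ] φ₁ a ≡ r ∷ʳ suc a
φ₁-last a = T a , φ₁-shape a

open Synchronisation φ₁ (λ a → a) φ₁-head (λ e → e) using (prefix-sync)

synchronised-overlap : ∀ {m} u₁ v u₃ L s₁ s₂ R c r → All (_< m) v →
  φ u₁ ≡ (L ++ s₁) ∷ʳ m → φ v ≡ (s₂ ++ s₁) ∷ʳ m → φ u₃ ++ T m ≡ s₂ ++ c ∷ R → s₁ ∷ʳ m ≡ c ∷ r →
  ¬ OverlapFree (u₁ ++ v ++ u₃)
synchronised-overlap {m} u₁ v u₃ L s₁ s₂ R c r v<m eu₁ ev eu₃ ecr ovf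
  with suffix-sync φ₁ suc φ₁-last suc-injective u₁ v L s₂ (s₁ ∷ʳ m)
         (trans eu₁ (++-assoc L s₁ [ m ])) (trans ev (++-assoc s₂ s₁ [ m ]))
     | prefix-sync u₃ v (T m) (s₂ ∷ʳ c) R r (All-map (λ b<m e → <⇒≢ b<m (sym (just-injective e))) v<m)
         (trans eu₃ (sym (++-assoc s₂ [ c ] R)))
         (trans ev (trans (++-assoc s₂ s₁ [ m ]) (trans (cong (s₂ ++_) ecr) (sym (++-assoc s₂ [ c ] r)))))
... | γ₁ , u₁′ , v′ , refl , ev₁ , le₁ | γ₂ , u₃′ , v″ , refl , ev₂ , le₂ =
  OverlapFree-Factor factor ovf
    (bordered-overlap γ₁ γ₂ v v′ v″ ev₁ ev₂ (separated-by-weight φ₁ v γ₁ γ₂ light))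
  where
  factor : Factor (γ₁ ++ v ++ γ₂) ((u₁′ ++ γ₁) ++ v ++ γ₂ ++ u₃′)
  factor = u₁′ , u₃′ , solve (++-monoid ℕ)
  light : length (φ v) < length (φ γ₁) + length (φ γ₂)
  light = begin-strict
    length (φ v)                         ≡⟨ cong length (trans ev (++-assoc s₂ s₁ [ m ])) ⟩
    length (s₂ ++ s₁ ∷ʳ m)               ≡⟨ length-++ s₂ ⟩
    length s₂ + length (s₁ ∷ʳ m)         ≡⟨ +-comm (length s₂) _ ⟩
    length (s₁ ∷ʳ m) + length s₂         <⟨ +-monoʳ-< (length (s₁ ∷ʳ m)) (m<m+n (length s₂) z<s) ⟩
    length (s₁ ∷ʳ m) + (length s₂ + 1)   ≡⟨ cong (length (s₁ ∷ʳ m) +_) (sym (length-++ s₂)) ⟩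
    length (s₁ ∷ʳ m) + length (s₂ ∷ʳ c)  ≤⟨ +-mono-≤ le₁ le₂ ⟩
    length (φ γ₁) + length (φ γ₂)        ∎
    where open ≤-Reasoning

first-m-not-first-of-T : ∀ {k} u L s₁ s₂ c R → L ++ s₁ ≡ φ u →
  s₂ ++ s₁ ++ suc k ∷ s₂ ++ c ∷ R ≡ Y (suc k) ++ suc k ∷ Y (suc k) → ⊥
first-m-not-first-of-T {k} u L s₁ s₂ c R ex ez
  with split-at-unique (Y (suc k)) (Y (suc k)) (s₂ ++ s₁) (s₂ ++ c ∷ R) (∉-Y (suc k)) (∉-Y (suc k))
         (trans (sym ez) (sym (++-assoc s₂ s₁ _)))
... | e₁ , e₂ with EndsWith-++⁻ʳ s₂ s₁ (subst (EndsWith 0) (sym e₁) (Y-ends-with-0 k))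
...   | inj₂ s₁-ends = φ-not-ends-with-0 u (subst (EndsWith 0) ex (EndsWith-++⁺ʳ L s₁-ends))
...   | inj₁ refl with () ← ++-identityʳ-unique s₂ (trans (sym (++-identityʳ s₂)) (trans e₁ (sym e₂)))

second-m-not-first-of-T : ∀ {k} u₁ u₂ L s₁ s₂ c R r → s₁ ∷ʳ suc k ≡ c ∷ r →
  φ u₁ ≡ (L ++ s₁) ∷ʳ suc k → s₂ ++ s₁ ≡ φ u₂ → s₂ ++ c ∷ R ≡ Y (suc k) ++ suc k ∷ Y (suc k) → ⊥
second-m-not-first-of-T {k} u₁ u₂ L [] s₂ c R r ecr ef ex ez with ∷-injective ecr
... | refl , _ with split-at-unique (Y (suc k)) (Y (suc k)) s₂ R (∉-Y (suc k)) (∉-Y (suc k)) (sym ez)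
...   | refl , _ = φ-not-ends-with-0 u₂ (subst (EndsWith 0) (trans (sym (++-identityʳ s₂)) ex) (Y-ends-with-0 k))
second-m-not-first-of-T u₁ u₂ L (s ∷ s₁) s₂ c R r ecr ef ex ez with φ-last u₁ ef
... | _ , _ , ends with EndsWith-++⁻ʳ L (s ∷ s₁) ends
...   | inj₂ s₁-ends = φ-not-ends-with-0 u₂ (subst (EndsWith 0) ex (EndsWith-++⁺ʳ s₂ s₁-ends))

-- With c ∷ x = s₁ ++ m ∷ s₂ and m ∉ s₁ the overlap reads L s₁ m s₂ s₁ m s₂ c R;
-- the proof classifies its two m's that lie one period apart.
no-overlap-containing-m : ∀ m u → All (_< m) u → OverlapFree u → ∀ c x → m ∈ c ∷ x →
                         ¬ Factor (overlapWord c x) (φ u ++ T m)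
no-overlap-containing-m zero [] _ _ c x _ (L , R , eq) with overlap-length (L , R , c , x , eq)
... | s≤s (s≤s ())
no-overlap-containing-m zero (_ ∷ _) (() ∷ _)
no-overlap-containing-m m@(suc k) u u<m ovf c x m∈cx (L , R , eq)
  with split-at-first _≟_ (c ∷ x) m∈cx
... | s₁ , s₂ , ecx , m∉s₁
  with head-of-∷ʳ s₁ s₂ ecx
     | occurrence u u<m (L ++ s₁) (s₂ ++ s₁ ++ m ∷ s₂ ++ c ∷ R)
         (trans eq (trans (cong (λ w → L ++ (w ++ w ++ [ c ]) ++ R) ecx) (rearrange L s₁ [ m ] s₂ [ c ] R)))
  where
  rearrange : ∀ L s₁ M s₂ C R → L ++ ((s₁ ++ M ++ s₂) ++ (s₁ ++ M ++ s₂) ++ C) ++ R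
                              ≡ (L ++ s₁) ++ M ++ (s₂ ++ s₁ ++ M ++ s₂ ++ C ++ R)
  rearrange L s₁ M s₂ C R = solve (++-monoid ℕ)
... | r , ecr | second-of-T _ ez = ∉-Y m (subst (m ∈_) ez (∈-++⁺ʳ s₂ (∈-insert s₁)))
... | r , ecr | first-of-T ex ez = first-m-not-first-of-T u L s₁ s₂ c R ex ez
... | r , ecr | in-image u₁ u₂ refl ef ez
  with occurrence u₂ (++⁻ʳ u₁ u<m) (s₂ ++ s₁) (s₂ ++ c ∷ R) (trans (sym ez) (sym (++-assoc s₂ s₁ _)))
...   | first-of-T ex ez′ = second-m-not-first-of-T u₁ u₂ L s₁ s₂ c R r ecr ef ex ez′
...   | in-image v u₃ refl ev ez′ =
  synchronised-overlap u₁ v u₃ L s₁ s₂ R c r (++⁻ˡ v (++⁻ʳ u₁ u<m)) ef ev (sym ez′) ecr ovf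
...   | second-of-T ex ez′ with ∈-++⁻ s₂ (subst (m ∈_) (sym ex) (∈-++⁺ʳ (φ u₂) (here refl)))
...     | inj₁ m∈s₂ = ∉-Y m (subst (m ∈_) ez′ (∈-++⁺ˡ m∈s₂))
...     | inj₂ m∈s₁ = m∉s₁ m∈s₁

φ-around : ∀ p a w → φ (p ++ a ∷ w) ≡ (φ p ++ T a) ++ suc a ∷ φ w
φ-around p a w = begin
  φ (p ++ a ∷ w)                  ≡⟨ concatMap-++ φ₁ p (a ∷ w) ⟩
  φ p ++ φ₁ a ++ φ w              ≡⟨ cong (λ z → φ p ++ z ++ φ w) (φ₁-shape a) ⟩
  φ p ++ (T a ∷ʳ suc a) ++ φ w    ≡⟨ cong (φ p ++_) (++-assoc (T a) [ suc a ] (φ w)) ⟩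
  φ p ++ T a ++ suc a ∷ φ w       ≡⟨ sym (++-assoc (φ p) (T a) (suc a ∷ φ w)) ⟩
  (φ p ++ T a) ++ suc a ∷ φ w     ∎
  where open ≡-Reasoning

Factor-inside-T : ∀ {o b} → suc b ∉ o → Factor o (Y (suc b) ++ suc b ∷ Y (suc b)) → Factor o (φ (P b))
Factor-inside-T {o} {b} b+1∉o fac = subst (Factor o) (sym (φ-P b (φ₁-shape b)))
  (Factor-++⁺ˡ [ suc b ] ([ id , id ]′ (Factor-avoiding (Y (suc b)) (Y (suc b)) b+1∉o fac)))

Located : ℕ → Word → Set
Located m o = ∃[ u ] All (_< m) u × OverlapFree u × Factor o (φ u ++ T m)

locate-in-block : ∀ {m o a} p → All (_≤ m) o → All (_< m) p → OverlapFree p → m ≤ a →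
  (∀ b → suc b ≤ a → Factor o (φ (P b)) → Located m o) → Factor o (φ p ++ T a) → Located m o
locate-in-block p o≤m p<m p-free m≤a inside-T fac with m≤n⇒m<n∨m≡n m≤a
... | inj₂ refl = p , p<m , p-free , fac
... | inj₁ m<a@(s≤s {n = b} _)
  with Factor-avoiding (φ p) (Y (suc b) ++ suc b ∷ Y (suc b)) (∉-above o≤m m<a) fac
...   | inj₁ fac-p = p , p<m , p-free , Factor-++⁺ˡ (T _) fac-p
...   | inj₂ fac-T = inside-T b ≤-refl (Factor-inside-T (∉-above o≤m m<a) fac-T)

located-at-end : ∀ {m o} p → All (_< m) p → OverlapFree (p ++ []) → Factor o (φ (p ++ [])) → Located m o
located-at-end {m} {o} p p<m ovf fac =
  p , p<m , subst OverlapFree (++-identityʳ p) ovf ,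
  Factor-++⁺ˡ (T m) (subst (Factor o ∘ φ) (++-identityʳ p) fac)

-- p is the run of letters below m read since the last letter ≥ m.
locate : ∀ n → (∀ j → suc j < n → OverlapFree (P j)) → ∀ {m o} → All (_≤ m) o →
         ∀ p w → All (_< m) p → All (_< n) w → OverlapFree (p ++ w) → Factor o (φ (p ++ w)) → Located m o
locate zero    _      _   p []      p<m _        = located-at-end p p<m
locate zero    _      _   _ (_ ∷ _) _   (() ∷ _)
locate (suc n) P-free {m} {o} o≤m = scan
  where
  inside-T : ∀ {a} b → suc b ≤ a → a ≤ n → Factor o (φ (P b)) → Located m o
  inside-T b b<a a≤n = locate n (λ j j+1<n → P-free j (m<n⇒m<1+n j+1<n)) o≤m [] (P b) []
                         (All-map (λ c≤b → ≤-trans (s≤s c≤b) (≤-trans b<a a≤n)) (P-bounded (Y-bounded b)))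
                         (P-free b (s≤s (≤-trans b<a a≤n)))

  scan : ∀ p w → All (_< m) p → All (_< suc n) w → OverlapFree (p ++ w) → Factor o (φ (p ++ w)) → Located m o
  scan p []      p<m _                  = located-at-end p p<m
  scan p (a ∷ w) p<m (s≤s a≤n ∷ w<n) ovf fac with a <? m
  ... | yes a<m = scan (p ∷ʳ a) w (++⁺ p<m (a<m ∷ [])) w<n
                    (subst OverlapFree (sym (∷ʳ-++ p a w)) ovf) (subst (Factor o ∘ φ) (sym (∷ʳ-++ p a w)) fac)
  ... | no a≮m
    with Factor-avoiding (φ p ++ T a) (φ w) (∉-above o≤m (s≤s (≮⇒≥ a≮m)))
                         (subst (Factor o) (φ-around p a w) fac)
  ...   | inj₂ fac-w = scan [] w [] w<n
                         (OverlapFree-Factor (subst (Factor w) (∷ʳ-++ p a w) (Factor-suffix (p ∷ʳ a) w)) ovf) fac-w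
  ...   | inj₁ fac-pT =
    locate-in-block p o≤m p<m (OverlapFree-Factor (Factor-prefix p (a ∷ w)) ovf) (≮⇒≥ a≮m)
                    (λ b b<a → inside-T b b<a a≤n) fac-pT

max-letter : ∀ c x → ∃[ m ] m ∈ c ∷ x × All (_≤ m) (c ∷ x)
max-letter c x = max c x , [ here , there ]′ (argmax-sel id c x) , ⊥≤max c x ∷ xs≤max c x

OverlapFreeOn : ℕ → Set
OverlapFreeOn n = ∀ w → All (_< n) w → OverlapFree w → OverlapFree (φ w)

OverlapFreeOn-mono : ∀ {k n} → k ≤ n → OverlapFreeOn n → OverlapFreeOn k
OverlapFreeOn-mono k≤n φ-ovf w w<k = φ-ovf w (All-map (λ c<k → <-≤-trans c<k k≤n) w<k)

OverlapFreeOn-from-P : ∀ n → (∀ j → suc j < n → OverlapFree (P j)) → OverlapFreeOn n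
OverlapFreeOn-from-P n P-free w w<n ovf (L , R , c , x , eq) with max-letter c x
... | m , m∈cx , cx≤m
  with locate n P-free (++⁺ cx≤m (++⁺ cx≤m (lookup cx≤m (here refl) ∷ []))) [] w [] w<n ovf (L , R , eq)
...   | u , u<m , ovu , fac = no-overlap-containing-m m u u<m ovu c x m∈cx fac

P-overlapFree : ∀ j → OverlapFreeOn j → OverlapFree (P j)
P-overlapFree zero _ ov with overlap-length ov
... | s≤s ()
P-overlapFree (suc j) φ-ovf = subst OverlapFree (φ-P j (φ₁-shape j))
  (φ-ovf (P j) (All-map s≤s (P-bounded (Y-bounded j))) (P-overlapFree j (OverlapFreeOn-mono (n≤1+n j) φ-ovf)))

φ-overlapFreeOn : ∀ n → OverlapFreeOn n
φ-overlapFreeOn zero    = OverlapFreeOn-from-P zero (λ _ ())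
φ-overlapFreeOn (suc n) = OverlapFreeOn-from-P (suc n)
  (λ j j+1<n+1 → P-overlapFree j (OverlapFreeOn-mono (<⇒≤ (≤-pred j+1<n+1)) (φ-overlapFreeOn n)))

theorem6 : ((h : ℕ) → (w : Word) → All (_≤ h) w → OverlapFree w → OverlapFree (φₕ h w))
    × ((w : Word) → OverlapFree w → OverlapFree (φ w))
theorem6 = (λ h w w≤h ovf → subst OverlapFree (sym (φₕ-φ h w w≤h))
                               (φ-overlapFreeOn (suc h) w (All-map s≤s w≤h) ovf))
         , (λ w → φ-overlapFreeOn (suc (max 0 w)) w (All-map s≤s (xs≤max 0 w)))
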